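{- If an oriented graph $D$ does not contain any transitive triangle, then $D$ has a Sullivan vertex, i.e. a vertex $u$ with $|N^{++}(u)|\ge |N^-(u)|$.
   Context: An oriented graph is a loopless digraph $D=(V,A)$ in which $xy\in A$ implies $yx\notin A$. $N^-(u)=\{v: vu\in A\}$, $N^+(u)=\{v:uv\in A\}$, $N^{++}(u)=\{v\in V: uw,wv\in A \text{ for some } w\}\setminus N^+(u)$. A transitive triangle is an orientation of $K_3$ having a source (a vertex dominating the other two). -}

module Defs where

open import Data.Nat using (ℕ; _≤_)
open import Data.Bool using (Bool; true; false; _∧_; not; T)
open import Data.Fin using (Fin)
open import Data.Fin.Subset using (Subset; ∣_∣)
open import Data.Vec using (tabulate)
open import Data.Bool.ListAction using (any)
open import Data.List using () renaming (allFin to allFinL)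
open import Data.Product using (Σ; ∃; _×_)
open import Relation.Nullary using (¬_)

Digraph : ℕ → Set
Digraph n = Fin n → Fin n → Bool

module _ {n : ℕ} (D : Digraph n) where

  Arc : Fin n → Fin n → Set
  Arc x y = T (D x y)

  IsOriented : Set
  IsOriented = (∀ x → ¬ Arc x x) × (∀ x y → Arc x y → ¬ Arc y x)

  -- transitive triangle: a source x dominating y and z, with an arc y → z
  -- (three vertices, all distinct since D is oriented/loopless)
  HasTransitiveTriangle : Set
  HasTransitiveTriangle =
    Σ (Fin n) λ x → Σ (Fin n) λ y → Σ (Fin n) λ z →
      Arc x y × Arc x z × Arc y z

  inNbhd : Fin n → Subset n
  inNbhd u = tabulate λ v → D v u

  outNbhd : Fin n → Subset n
  outNbhd u = tabulate λ v → D u v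

  secondOutNbhd : Fin n → Subset n
  secondOutNbhd u =
    tabulate λ v → any (λ w → D u w ∧ D w v) (allFinL n) ∧ not (D u v)

  IsSullivanVertex : Fin n → Set
  IsSullivanVertex u = ∣ inNbhd u ∣ ≤ ∣ secondOutNbhd u ∣

-- Count the arcs uw weighted by d⁺(w) and by d⁻(u): both sums equal Σ_v d⁻(v) d⁺(v).
-- Hence if every arc uw had d⁺(w) < d⁻(u), the second sum would exceed the first
-- by at least the number of arcs, so D would have no arcs and every vertex would be
-- Sullivan. Otherwise some arc uw has d⁻(u) ≤ d⁺(w), and without transitive
-- triangles N⁺(w) ⊆ N⁺⁺(u), so u is a Sullivan vertex.
module Submission where

open import Defs
open import Data.Nat using (ℕ; suc; zero; _+_; _*_; _≤_; _<_; z≤n; _≤?_)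
open import Data.Nat.Properties
open import Algebra.Properties.Semiring.Sum +-*-semiring
  using (sum; sum-cong-≗; ∑-comm; ∑-distrib-+; *-distribʳ-sum)
open import Data.Fin using (Fin; zero; suc)
open import Data.Fin.Properties using (any?)
open import Data.Fin.Subset using (∣_∣; _∈_; _⊆_)
open import Data.Fin.Subset.Properties using (p⊆q⇒∣p∣≤∣q∣)
open import Data.Bool using (Bool; true; false; T)
open import Data.Bool.Properties using (T?; T-≡; T-∧; T-not-≡; ¬-not)
open import Data.List.Relation.Unary.Any.Properties using (any⁺)
open import Data.List.Membership.Propositional using (lose)
open import Data.List.Membership.Propositional.Properties using (∈-allFin)
open import Data.Vec using (tabulate)
open import Data.Vec.Properties using (lookup∘tabulate; []=⇒lookup; lookup⇒[]=)
open import Data.Product using (∃; _,_)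
open import Function using (_∘_; Equivalence)
open import Relation.Nullary using (¬_; yes; no)
open import Relation.Nullary.Decidable using (_×-dec_)
open import Relation.Binary.PropositionalEquality
open Equivalence using (to; from)

indicator : Bool → ℕ
indicator true  = 1
indicator false = 0

∣tabulate∣≡sum : ∀ {n} (f : Fin n → Bool) → ∣ tabulate f ∣ ≡ sum (indicator ∘ f)
∣tabulate∣≡sum {zero}  f = refl
∣tabulate∣≡sum {suc n} f with f zero
... | true  = cong suc (∣tabulate∣≡sum (f ∘ suc))
... | false = ∣tabulate∣≡sum (f ∘ suc)

∈-tabulate⁺ : ∀ {n} {f : Fin n → Bool} {x} → T (f x) → x ∈ tabulate f
∈-tabulate⁺ {f = f} {x} fx = lookup⇒[]= x _ (trans (lookup∘tabulate f x) (to T-≡ fx))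

∈-tabulate⁻ : ∀ {n} {f : Fin n → Bool} {x} → x ∈ tabulate f → T (f x)
∈-tabulate⁻ {f = f} {x} x∈ = from T-≡ (trans (sym (lookup∘tabulate f x)) ([]=⇒lookup x∈))

sum-mono-≤ : ∀ {n} {f g : Fin n → ℕ} → (∀ i → f i ≤ g i) → sum f ≤ sum g
sum-mono-≤ {zero}  f≤g = z≤n
sum-mono-≤ {suc n} f≤g = +-mono-≤ (f≤g zero) (sum-mono-≤ (f≤g ∘ suc))

lookup≤sum : ∀ {n} (f : Fin n → ℕ) i → f i ≤ sum f
lookup≤sum f zero    = m≤m+n _ _
lookup≤sum f (suc i) = ≤-trans (lookup≤sum (f ∘ suc) i) (m≤n+m _ _)

module _ {n : ℕ} (D : Digraph n) where

  arcWeight : Fin n → Fin n → ℕ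
  arcWeight u w = indicator (D u w)

  indegree : Fin n → ℕ
  indegree w = sum λ u → arcWeight u w

  outdegree : Fin n → ℕ
  outdegree u = sum (arcWeight u)

  arcCount : ℕ
  arcCount = sum outdegree

  ∑arcs-by-head : (f : Fin n → ℕ) →
    sum (λ u → sum λ w → arcWeight u w * f w) ≡ sum (λ w → indegree w * f w)
  ∑arcs-by-head f = trans (∑-comm λ u w → arcWeight u w * f w)
    (sum-cong-≗ λ w → sym (*-distribʳ-sum (f w) λ u → arcWeight u w))

  ∑arcs-by-tail : (g : Fin n → ℕ) →
    sum (λ u → sum λ w → arcWeight u w * g u) ≡ sum (λ u → outdegree u * g u)
  ∑arcs-by-tail g = sum-cong-≗ λ u → sym (*-distribʳ-sum (g u) (arcWeight u))

  indegree≤arcCount : ∀ w → indegree w ≤ arcCount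
  indegree≤arcCount w = sum-mono-≤ λ u → lookup≤sum (arcWeight u) w

  arcCount≡0-if-outdegree<indegree :
    (∀ u w → Arc D u w → outdegree w < indegree u) → arcCount ≡ 0
  arcCount≡0-if-outdegree<indegree descends = n≤0⇒n≡0 (+-cancelʳ-≤ S arcCount 0 (begin
    arcCount + S
      ≡⟨ cong (arcCount +_) (∑arcs-by-head outdegree) ⟨
    arcCount + sum (λ u → sum λ w → arcWeight u w * outdegree w)
      ≡⟨ ∑-distrib-+ outdegree (λ u → sum λ w → arcWeight u w * outdegree w) ⟨
    sum (λ u → outdegree u + sum λ w → arcWeight u w * outdegree w)
      ≡⟨ sum-cong-≗ (λ u → ∑-distrib-+ (arcWeight u) (λ w → arcWeight u w * outdegree w)) ⟨
    sum (λ u → sum λ w → arcWeight u w + arcWeight u w * outdegree w)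
      ≡⟨ sum-cong-≗ (λ u → sum-cong-≗ λ w → *-suc (arcWeight u w) (outdegree w)) ⟨
    sum (λ u → sum λ w → arcWeight u w * suc (outdegree w))
      ≤⟨ sum-mono-≤ (λ u → sum-mono-≤ λ w → weighted-descent u w) ⟩
    sum (λ u → sum λ w → arcWeight u w * indegree u)
      ≡⟨ ∑arcs-by-tail indegree ⟩
    sum (λ u → outdegree u * indegree u)
      ≡⟨ sum-cong-≗ (λ u → *-comm (outdegree u) (indegree u)) ⟩
    S ∎))
    where
    open ≤-Reasoning
    weighted-descent : ∀ u w → arcWeight u w * suc (outdegree w) ≤ arcWeight u w * indegree u
    weighted-descent u w with D u w in uw
    ... | true  = *-monoʳ-≤ 1 (descends u w (from T-≡ uw))
    ... | false = z≤n
    S : ℕ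
    S = sum λ w → indegree w * outdegree w

  outNbhd⊆secondOutNbhd : ¬ HasTransitiveTriangle D →
    ∀ {u w} → Arc D u w → outNbhd D w ⊆ secondOutNbhd D u
  outNbhd⊆secondOutNbhd noTriangle {u} {w} uw {v} v∈N⁺w = ∈-tabulate⁺ (from T-∧
    ( any⁺ _ (lose (∈-allFin w) (from T-∧ (uw , wv)))
    , from T-not-≡ (¬-not λ uv → noTriangle (u , w , v , uw , from T-≡ uv , wv)) ))
    where
    wv : Arc D w v
    wv = ∈-tabulate⁻ v∈N⁺w

  isSullivan-if-indegree≤outdegree : ¬ HasTransitiveTriangle D →
    ∀ {u w} → Arc D u w → indegree u ≤ outdegree w → IsSullivanVertex D u
  isSullivan-if-indegree≤outdegree noTriangle {u} {w} uw d⁻u≤d⁺w = begin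
    ∣ inNbhd D u ∣        ≡⟨ ∣tabulate∣≡sum (λ v → D v u) ⟩
    indegree u            ≤⟨ d⁻u≤d⁺w ⟩
    outdegree w           ≡⟨ ∣tabulate∣≡sum (D w) ⟨
    ∣ outNbhd D w ∣       ≤⟨ p⊆q⇒∣p∣≤∣q∣ (outNbhd⊆secondOutNbhd noTriangle uw) ⟩
    ∣ secondOutNbhd D u ∣ ∎
    where open ≤-Reasoning

  isSullivan-if-arcCount≡0 : arcCount ≡ 0 → ∀ u → IsSullivanVertex D u
  isSullivan-if-arcCount≡0 noArcs u = begin
    ∣ inNbhd D u ∣ ≡⟨ ∣tabulate∣≡sum (λ v → D v u) ⟩
    indegree u     ≤⟨ indegree≤arcCount u ⟩
    arcCount       ≡⟨ noArcs ⟩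
    0              ≤⟨ z≤n ⟩
    ∣ secondOutNbhd D u ∣ ∎
    where open ≤-Reasoning

corollary3p2 : (n : ℕ) → (D : Digraph (suc n)) → IsOriented D →
    ¬ HasTransitiveTriangle D → ∃ λ (u : Fin (suc n)) → IsSullivanVertex D u
corollary3p2 n D _ noTriangle
  with any? (λ u → any? λ w → T? (D u w) ×-dec (indegree D u ≤? outdegree D w))
... | yes (u , w , uw , d⁻u≤d⁺w) =
  u , isSullivan-if-indegree≤outdegree D noTriangle uw d⁻u≤d⁺w
... | no noSuchArc =
  zero , isSullivan-if-arcCount≡0 D (arcCount≡0-if-outdegree<indegree D descends) zero
  where
  descends : ∀ u w → Arc D u w → outdegree D w < indegree D u
  descends u w uw = ≰⇒> λ d⁻u≤d⁺w → noSuchArc (u , w , uw , d⁻u≤d⁺w)
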